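{- Every finite simple undirected graph $G$ of minimum degree at least $4$ has a majority $3$-edge-coloring, i.e., an edge-coloring $c:E(G)\to\{1,2,3\}$ such that for every vertex $u$ of $G$ and every color $\alpha\in\{1,2,3\}$, at most half of the edges incident with $u$ have color $\alpha$.
   Context: A majority $k$-edge-coloring of a graph $G$ is an edge-coloring $c:E(G)\to\{1,\dots,k\}$ such that, for every vertex $u$ and every color $\alpha$, at most $d_G(u)/2$ of the edges incident with $u$ have color $\alpha$. -}

module Defs where

open import Data.Nat using (ℕ; _≤_; _*_)
open import Data.Bool using (Bool; true; false; _∧_)
open import Data.Fin using (Fin)
open import Data.Fin.Properties using (_≟_)
open import Data.List using (List; filter; length)
open import Relation.Binary.PropositionalEquality using (_≡_)
open import Relation.Nullary.Decidable using (⌊_⌋)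
open import Data.List.Base using (allFin)

record SimpleGraph (n : ℕ) : Set where
  field
    Adj   : Fin n → Fin n → Bool
    symm  : ∀ u v → Adj u v ≡ Adj v u
    irrefl : ∀ u → Adj u u ≡ false
open SimpleGraph public

countB : ∀ {n} → (Fin n → Bool) → ℕ
countB {n} p = length (Data.List.filter (λ v → Data.Bool._≟_ (p v) true) (allFin n))

degree : ∀ {n} → SimpleGraph n → Fin n → ℕ
degree G u = countB (Adj G u)

-- An edge-coloring with k colors: each edge uv gets a color; represented as a
-- function on ordered vertex pairs that agrees on both orientations of an edge
-- (values on non-adjacent pairs are irrelevant).
record EdgeColoring {n : ℕ} (G : SimpleGraph n) (k : ℕ) : Set where
  field
    col  : Fin n → Fin n → Fin k
    col-sym : ∀ u v → Adj G u v ≡ true → col u v ≡ col v u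
open EdgeColoring public

colorDegree : ∀ {n k} {G : SimpleGraph n} → EdgeColoring G k → Fin n → Fin k → ℕ
colorDegree {G = G} c u α = countB (λ v → Adj G u v ∧ ⌊ col c u v ≟ α ⌋)

-- majority coloring: for every vertex u and color α, at most d(u)/2 edges
-- at u have color α (stated as 2·count ≤ d(u), equivalent over ℕ without division)
IsMajority : ∀ {n k} {G : SimpleGraph n} → EdgeColoring G k → Set
IsMajority {G = G} c = ∀ u α → 2 * colorDegree c u α ≤ degree G u

MinDegreeAtLeast : ∀ {n} → SimpleGraph n → ℕ → Set
MinDegreeAtLeast G d = ∀ u → d ≤ degree G u

-- Take a 3-edge-colouring minimising Φ = Σ_v Σ_κ d_κ(v)², where d_κ(v) counts the edges of
-- colour κ at v, and, among those, the total excess Σ_v Σ_κ (2 d_κ(v) ∸ d(v)).  If colour α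
-- has a strict majority at u, let β be the rarer of the other two colours there; as d(u) ≥ 4,
-- d_α(u) ≥ d_β(u) + 2.  Grow a maximal trail from u whose edges are coloured α, β, α, … and
-- swap α and β on it.  Inner vertices keep their colour counts, the far end of an open trail
-- does not get worse by maximality, and u trades one α-edge (two, if the trail returns to u)
-- for β-edges, which lowers Φ.  The one exception is a trail closing at u with colour counts
-- (3, 1, 1) at u.  Then recolouring a single α-edge uv of the trail (to β or to γ, or after
-- swapping the trail, back from β to α) lowers Φ, or keeps Φ and removes the excess at u
-- without creating any at v.

module Submission where

open import Defs
open import Data.Bool using (Bool; true; false; _∧_; _∨_; not; if_then_else_)
open import Data.Bool.Properties using (∨-comm; ∧-comm; ∧-zeroʳ; ∧-identityʳ; not-involutive)
import Data.Bool as Bool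
open import Data.Fin using (Fin; zero; suc)
open import Data.Fin.Properties using (_≟_; any?; all?; ¬∀⟶∃¬; suc-injective)
open import Data.List using (length; filter; tabulate)
open import Data.Nat using (ℕ; zero; suc; _+_; _*_; _∸_; _≤_; _<_; _≤?_; z≤n; s≤s; NonZero)
open import Data.Nat.Properties hiding (_≟_; suc-injective)
open import Algebra.Properties.CommutativeMonoid.Sum +-0-commutativeMonoid
  using (sum; sum-cong-≗; ∑-distrib-+; ∑-comm; sum-permute)
open import Algebra.Properties.CommutativeSemigroup +-commutativeSemigroup using (xy∙z≈xz∙y; xy∙z≈zy∙x)
open import Data.Nat.Tactic.RingSolver using (solve-∀)
open import Data.Product using (Σ; ∃; _×_; _,_; proj₁; proj₂)
open import Data.Sum using (_⊎_; inj₁; inj₂)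
open import Function using (_∘_)
open import Data.Fin.Patterns using (0F; 1F; 2F)
open import Data.Fin.Permutation using (Permutation; _⟨$⟩ʳ_; _⟨$⟩ˡ_; _∘ₚ_; inverseˡ; inverseʳ; transpose)
open import Data.Vec.Functional using (updateAt)
open import Data.Vec.Functional.Properties using (updateAt-updates; updateAt-minimal)
open import Relation.Binary using (tri<; tri≈; tri>)
open import Relation.Binary.PropositionalEquality
open import Relation.Nullary using (¬_; Dec; yes; no; contradiction)
open import Relation.Nullary.Decidable using (⌊_⌋; dec-true; dec-false; _×-dec_)
open import Induction.WellFounded using (Acc; acc; WellFounded)
open import Relation.Binary.Construct.On as On using ()
open import Data.Product.Relation.Binary.Lex.Strict using (×-Lex; ×-wellFounded)
open import Data.Nat.Induction using (<-wellFounded)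
import Data.Fin.Permutation.Components as PC

𝟙 : Bool → ℕ
𝟙 true = 1
𝟙 false = 0

sum-zero : ∀ {n} {f : Fin n → ℕ} → (∀ i → f i ≡ 0) → sum f ≡ 0
sum-zero {zero} _ = refl
sum-zero {suc n} f≡0 = cong₂ _+_ (f≡0 zero) (sum-zero (f≡0 ∘ suc))

sum-mono-≤ : ∀ {n} {f g : Fin n → ℕ} → (∀ i → f i ≤ g i) → sum f ≤ sum g
sum-mono-≤ {zero} _ = z≤n
sum-mono-≤ {suc n} f≤g = +-mono-≤ (f≤g zero) (sum-mono-≤ (f≤g ∘ suc))

sum-mono-< : ∀ {n} {f g : Fin n → ℕ} (a : Fin n) → (∀ i → f i ≤ g i) → f a < g a → sum f < sum g
sum-mono-< zero f≤g fa<ga = +-mono-<-≤ fa<ga (sum-mono-≤ (f≤g ∘ suc))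
sum-mono-< (suc a) f≤g fa<ga = +-mono-≤-< (f≤g zero) (sum-mono-< a (f≤g ∘ suc) fa<ga)

sum-single : ∀ {n} {f : Fin n → ℕ} a → (∀ i → i ≢ a → f i ≡ 0) → sum f ≡ f a
sum-single {f = f} zero f≡0 =
  trans (cong (f zero +_) (sum-zero (λ i → f≡0 (suc i) λ ()))) (+-identityʳ (f zero))
sum-single (suc a) f≡0 =
  cong₂ _+_ (f≡0 zero λ ()) (sum-single a (λ i i≢a → f≡0 (suc i) (i≢a ∘ suc-injective)))

sum-update : ∀ {n} {f g : Fin n → ℕ} a → (∀ i → i ≢ a → f i ≡ g i) →
  sum f + g a ≡ sum g + f a
sum-update {f = f} {g} zero f≡g =
  trans (cong (λ t → f zero + t + g zero) (sum-cong-≗ λ i → f≡g (suc i) λ ()))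
        (xy∙z≈zy∙x (f zero) (sum (g ∘ suc)) (g zero))
sum-update {f = f} {g} (suc a) f≡g = begin
  f zero + sum (f ∘ suc) + g (suc a)   ≡⟨ +-assoc (f zero) _ _ ⟩
  f zero + (sum (f ∘ suc) + g (suc a)) ≡⟨ cong₂ _+_ (f≡g zero λ ()) rest ⟩
  g zero + (sum (g ∘ suc) + f (suc a)) ≡⟨ +-assoc (g zero) _ _ ⟨
  g zero + sum (g ∘ suc) + f (suc a)   ∎
  where
  open ≡-Reasoning
  rest = sum-update a λ i i≢a → f≡g (suc i) (i≢a ∘ suc-injective)

sum-update₂ : ∀ {n} {f g : Fin n → ℕ} {a b} → a ≢ b → (∀ i → i ≢ a → i ≢ b → f i ≡ g i) →
  sum f + (g a + g b) ≡ sum g + (f a + f b)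
sum-update₂ {f = f} {g} {a} {b} a≢b f≡g = begin
  sum f + (g a + g b)   ≡⟨ +-assoc (sum f) _ _ ⟨
  sum f + g a + g b     ≡⟨ cong (λ t → sum f + t + g b) (updateAt-updates a f) ⟨
  sum f + h a + g b     ≡⟨ cong (_+ g b) (sum-update a λ i i≢a → sym (updateAt-minimal i a f i≢a)) ⟩
  sum h + f a + g b     ≡⟨ xy∙z≈xz∙y (sum h) _ _ ⟩
  sum h + g b + f a     ≡⟨ cong (_+ f a) (sum-update b h≡g) ⟩
  sum g + h b + f a     ≡⟨ cong (λ t → sum g + t + f a) (updateAt-minimal b a f (a≢b ∘ sym)) ⟩
  sum g + f b + f a     ≡⟨ +-assoc (sum g) _ _ ⟩
  sum g + (f b + f a)   ≡⟨ cong (sum g +_) (+-comm (f b) (f a)) ⟩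
  sum g + (f a + f b)   ∎
  where
  open ≡-Reasoning
  h : Fin _ → ℕ
  h = updateAt f a (λ _ → g a)
  h≡g : ∀ i → i ≢ b → h i ≡ g i
  h≡g i i≢b with i ≟ a
  ... | yes refl = updateAt-updates a f
  ... | no i≢a = trans (updateAt-minimal i a f i≢a) (f≡g i i≢a i≢b)

countB≡sum : ∀ {n} (p : Fin n → Bool) → countB p ≡ sum (𝟙 ∘ p)
countB≡sum {n} p = count-tabulate n (λ i → i)
  where
  count-tabulate : ∀ m (g : Fin m → Fin n) →
    length (filter (λ v → p v Bool.≟ true) (tabulate g)) ≡ sum (𝟙 ∘ p ∘ g)
  count-tabulate zero g = refl
  count-tabulate (suc m) g with p (g zero)
  ... | true = cong suc (count-tabulate m (g ∘ suc))
  ... | false = count-tabulate m (g ∘ suc)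

<-from-shift : ∀ {a b c} t → a + t ≡ b → suc t + c ≤ b → c < a
<-from-shift {a} {b} {c} t a+t≡b 1+t+c≤b = +-cancelʳ-≤ t (suc c) a (subst₂ _≤_ (cong suc (+-comm t c)) (sym a+t≡b) 1+t+c≤b)

≤-from-shift : ∀ {a b c} t → a + t ≡ b → t + c ≤ b → c ≤ a
≤-from-shift {a} {b} {c} t a+t≡b t+c≤b = +-cancelʳ-≤ t c a (subst₂ _≤_ (+-comm t c) (sym a+t≡b) t+c≤b)

violation-cases : ∀ a b g → 4 ≤ a + (b + g) → b + g < a → b ≤ g → 3 + b ≤ a ⊎ (a ≡ 3 × b ≡ 1 × g ≡ 1)
violation-cases a b (suc (suc g)) _ b+g<a _ =
  inj₁ (≤-trans (s≤s (≤-trans (≤-reflexive (+-comm 2 b)) (+-monoʳ-≤ b (s≤s (s≤s z≤n))))) b+g<a)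
violation-cases a zero zero 4≤a _ _ = inj₁ (≤-trans (n≤1+n 3) (subst (4 ≤_) (+-identityʳ a) 4≤a))
violation-cases a zero (suc zero) 4≤a+1 _ _ = inj₁ (+-cancelʳ-≤ 1 3 a 4≤a+1)
violation-cases (suc (suc (suc zero))) (suc zero) (suc zero) _ _ _ = inj₂ (refl , refl , refl)
violation-cases (suc (suc (suc (suc a)))) (suc zero) (suc zero) _ _ _ = inj₁ (s≤s (s≤s (s≤s (s≤s z≤n))))
violation-cases zero (suc zero) (suc zero) _ () _
violation-cases (suc zero) (suc zero) (suc zero) _ (s≤s ()) _
violation-cases (suc (suc zero)) (suc zero) (suc zero) _ (s≤s (s≤s ())) _
violation-cases _ (suc _) zero _ _ ()
violation-cases _ (suc (suc _)) (suc zero) _ _ (s≤s ())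

violation-margin : ∀ {a b g} → 3 + b ≤ a ⊎ (a ≡ 3 × b ≡ 1 × g ≡ 1) → 2 + b ≤ a
violation-margin (inj₁ 3+b≤a) = <⇒≤ 3+b≤a
violation-margin (inj₂ (refl , refl , _)) = ≤-refl

room-for-one-more : ∀ {a g} → a ≤ g → 4 ≤ a + (a + g) → 2 * (a + 1) ≤ a + (a + g)
room-for-one-more {a} {suc (suc g)} _ _ = begin
  2 * (a + 1)          ≡⟨ expand a ⟩
  a + (a + 2)          ≤⟨ +-monoʳ-≤ a (+-monoʳ-≤ a (s≤s (s≤s z≤n))) ⟩
  a + (a + suc (suc g)) ∎
  where
  open ≤-Reasoning
  expand : ∀ a → 2 * (a + 1) ≡ a + (a + 2)
  expand = solve-∀
room-for-one-more {zero} {zero} _ ()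
room-for-one-more {zero} {suc zero} _ (s≤s ())
room-for-one-more {suc zero} {suc zero} _ (s≤s (s≤s (s≤s ())))
room-for-one-more {suc (suc _)} {suc zero} (s≤s ()) _

≟-refl : ∀ {k} (x : Fin k) → ⌊ x ≟ x ⌋ ≡ true
≟-refl x with x ≟ x
... | yes _ = refl
... | no x≢x = contradiction refl x≢x

≟-≢ : ∀ {k} {x y : Fin k} → x ≢ y → ⌊ x ≟ y ⌋ ≡ false
≟-≢ {x = x} {y} x≢y with x ≟ y
... | yes x≡y = contradiction x≡y x≢y
... | no _ = refl

transpose-i : ∀ {k} (i j : Fin k) → PC.transpose i j i ≡ j
transpose-i i j rewrite dec-true (i ≟ i) refl = refl

transpose-j : ∀ {k} {i j : Fin k} → i ≢ j → PC.transpose i j j ≡ i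
transpose-j {i = i} {j} i≢j rewrite dec-false (j ≟ i) (i≢j ∘ sym) | dec-true (j ≟ j) refl = refl

transpose-other : ∀ {k} {i j l : Fin k} → l ≢ i → l ≢ j → PC.transpose i j l ≡ l
transpose-other {i = i} {j} {l} l≢i l≢j rewrite dec-false (l ≟ i) l≢i | dec-false (l ≟ j) l≢j = refl

⟨$⟩ʳ-≟ : ∀ {k} (π : Permutation k k) x y → ⌊ π ⟨$⟩ʳ x ≟ y ⌋ ≡ ⌊ x ≟ π ⟨$⟩ˡ y ⌋
⟨$⟩ʳ-≟ π x y with x ≟ π ⟨$⟩ˡ y
... | yes refl = trans (cong (λ z → ⌊ z ≟ y ⌋) (inverseʳ π)) (≟-refl y)
... | no x≢π⁻¹y = ≟-≢ λ πx≡y → x≢π⁻¹y (trans (sym (inverseˡ π)) (cong (π ⟨$⟩ˡ_) πx≡y))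

sq : ℕ → ℕ
sq x = x * x

-- g arises from f by exchanging the colours p and q on a set of edges with colour counts s.
record Exchange {k} (f g s : Fin k → ℕ) (p q : Fin k) : Set where
  field
    at-p : g p + s p ≡ f p + s q
    at-q : g q + s q ≡ f q + s p
    elsewhere : ∀ κ → κ ≢ p → κ ≢ q → g κ ≡ f κ

module _ {k} {f g s : Fin k → ℕ} {p q : Fin k} (ex : Exchange f g s p q) where
  open Exchange ex

  exchange-flip : Exchange f g s q p
  exchange-flip = record { at-p = at-q ; at-q = at-p ; elsewhere = λ κ κ≢q κ≢p → elsewhere κ κ≢p κ≢q }

  exchange-balanced : s p ≡ s q → ∀ κ → g κ ≡ f κ
  exchange-balanced sp≡sq κ with κ ≟ p | κ ≟ q
  ... | yes refl | _ = +-cancelʳ-≡ (s p) _ _ (trans at-p (cong (f p +_) (sym sp≡sq)))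
  ... | no _ | yes refl = +-cancelʳ-≡ (s q) _ _ (trans at-q (cong (f q +_) sp≡sq))
  ... | no κ≢p | no κ≢q = elsewhere κ κ≢p κ≢q

  exchange-shift : ∀ {t} → s p ≡ s q + t → g p + t ≡ f p × g q ≡ f q + t
  exchange-shift {t} sp≡sq+t =
    +-cancelʳ-≡ (s q) _ _ (trans (+-assoc (g p) t (s q)) (trans (cong (g p +_) (trans (+-comm t (s q)) (sym sp≡sq+t))) at-p)) ,
    +-cancelʳ-≡ (s q) _ _ (trans at-q (trans (cong (f q +_) (trans sp≡sq+t (+-comm (s q) t))) (sym (+-assoc (f q) t (s q)))))

  exchange-sum-sq : p ≢ q → ∀ {t} → s p ≡ s q + t →
    sum (sq ∘ g) + 2 * t * g p ≡ sum (sq ∘ f) + 2 * t * f q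
  exchange-sum-sq p≢q {t} sp≡sq+t = +-cancelʳ-≡ K _ _ (begin
    sum (sq ∘ g) + 2 * t * g p + K            ≡⟨ expandˡ (sum (sq ∘ g)) (g p) (f q) t ⟩
    sum (sq ∘ g) + (sq (g p + t) + sq (f q))  ≡⟨ cong (λ z → sum (sq ∘ g) + (sq z + sq (f q))) (proj₁ shifted) ⟩
    sum (sq ∘ g) + (sq (f p) + sq (f q))      ≡⟨ sum-update₂ p≢q (λ κ κ≢p κ≢q → cong sq (elsewhere κ κ≢p κ≢q)) ⟩
    sum (sq ∘ f) + (sq (g p) + sq (g q))      ≡⟨ cong (λ z → sum (sq ∘ f) + (sq (g p) + sq z)) (proj₂ shifted) ⟩
    sum (sq ∘ f) + (sq (g p) + sq (f q + t))  ≡⟨ expandʳ (sum (sq ∘ f)) (g p) (f q) t ⟩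
    sum (sq ∘ f) + 2 * t * f q + K            ∎)
    where
    open ≡-Reasoning
    shifted = exchange-shift sp≡sq+t
    K = sq (g p) + sq (f q) + t * t
    expandˡ : ∀ X a b t → X + 2 * t * a + (a * a + b * b + t * t) ≡ X + ((a + t) * (a + t) + b * b)
    expandˡ = solve-∀
    expandʳ : ∀ Y a b t → Y + (a * a + (b + t) * (b + t)) ≡ Y + 2 * t * b + (a * a + b * b + t * t)
    expandʳ = solve-∀

  exchange-sum-sq-≤ : p ≢ q → ∀ {t} → s p ≡ s q + t → f q ≤ g p → sum (sq ∘ g) ≤ sum (sq ∘ f)
  exchange-sum-sq-≤ p≢q {t} sp≡sq+t fq≤gp =
    +-cancelʳ-≤ (2 * t * g p) _ _ (begin
      sum (sq ∘ g) + 2 * t * g p  ≡⟨ exchange-sum-sq p≢q sp≡sq+t ⟩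
      sum (sq ∘ f) + 2 * t * f q  ≤⟨ +-monoʳ-≤ (sum (sq ∘ f)) (*-monoʳ-≤ (2 * t) fq≤gp) ⟩
      sum (sq ∘ f) + 2 * t * g p  ∎)
    where open ≤-Reasoning

  exchange-sum-sq-< : p ≢ q → ∀ {t} .{{_ : NonZero t}} → s p ≡ s q + t → f q < g p →
    sum (sq ∘ g) < sum (sq ∘ f)
  exchange-sum-sq-< p≢q {t} sp≡sq+t fq<gp =
    +-cancelʳ-< (2 * t * g p) _ _ (begin-strict
      sum (sq ∘ g) + 2 * t * g p  ≡⟨ exchange-sum-sq p≢q sp≡sq+t ⟩
      sum (sq ∘ f) + 2 * t * f q  <⟨ +-monoʳ-< (sum (sq ∘ f)) (*-monoʳ-< (2 * t) {{m*n≢0 2 t}} fq<gp) ⟩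
      sum (sq ∘ f) + 2 * t * g p  ∎)
    where open ≤-Reasoning

  exchange-sum-sq-≤-saturated : p ≢ q → s p ≡ s q + 1 → s q ≡ f q → s p ≤ f p →
    sum (sq ∘ g) ≤ sum (sq ∘ f)
  exchange-sum-sq-≤-saturated p≢q sp≡sq+1 sq≡fq sp≤fp = exchange-sum-sq-≤ p≢q sp≡sq+1
    (+-cancelʳ-≤ 1 _ _ (begin
      f q + 1  ≡⟨ cong (_+ 1) sq≡fq ⟨
      s q + 1  ≡⟨ sp≡sq+1 ⟨
      s p      ≤⟨ sp≤fp ⟩
      f p      ≡⟨ proj₁ (exchange-shift sp≡sq+1) ⟨
      g p + 1  ∎))
    where open ≤-Reasoning

EdgeSet : ℕ → Set
EdgeSet n = Fin n → Fin n → Bool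

Undirected : ∀ {n} → EdgeSet n → Set
Undirected S = ∀ x y → S x y ≡ S y x

∅ : ∀ {n} → EdgeSet n
∅ _ _ = false

⟪_,_⟫ : ∀ {n} → Fin n → Fin n → EdgeSet n
⟪ x , w ⟫ y z = (⌊ y ≟ x ⌋ ∧ ⌊ z ≟ w ⌋) ∨ (⌊ y ≟ w ⌋ ∧ ⌊ z ≟ x ⌋)

_∪_ : ∀ {n} → EdgeSet n → EdgeSet n → EdgeSet n
(S ∪ T) y z = S y z ∨ T y z

∅-undirected : ∀ {n} → Undirected (∅ {n})
∅-undirected _ _ = refl

⟪⟫-undirected : ∀ {n} (x w : Fin n) → Undirected ⟪ x , w ⟫
⟪⟫-undirected x w y z =
  trans (∨-comm (⌊ y ≟ x ⌋ ∧ ⌊ z ≟ w ⌋) _) (cong₂ _∨_ (∧-comm ⌊ y ≟ w ⌋ _) (∧-comm ⌊ y ≟ x ⌋ _))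

∪-undirected : ∀ {n} {S T : EdgeSet n} → Undirected S → Undirected T → Undirected (S ∪ T)
∪-undirected S-und T-und y z = cong₂ _∨_ (S-und y z) (T-und y z)

⟪⟫-true : ∀ {n} {x w y z : Fin n} → ⟪ x , w ⟫ y z ≡ true → (y ≡ x × z ≡ w) ⊎ (y ≡ w × z ≡ x)
⟪⟫-true {x = x} {w} {y} {z} yz∈xw with y ≟ x | z ≟ w | y ≟ w | z ≟ x
... | yes y≡x | yes z≡w | _ | _ = inj₁ (y≡x , z≡w)
... | _ | _ | yes y≡w | yes z≡x = inj₂ (y≡w , z≡x)
... | no _ | _ | no _ | _ = contradiction yz∈xw λ ()
... | no _ | _ | yes _ | no _ = contradiction yz∈xw λ ()
... | yes _ | no _ | no _ | _ = contradiction yz∈xw λ ()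
... | yes _ | no _ | yes _ | no _ = contradiction yz∈xw λ ()

module _ {n : ℕ} (G : SimpleGraph n) where

  deg : Fin n → ℕ
  deg v = sum λ w → 𝟙 (Adj G v w)

  cdeg : ∀ {k} → EdgeColoring G k → Fin n → Fin k → ℕ
  cdeg c v κ = sum λ w → 𝟙 (Adj G v w ∧ ⌊ col c v w ≟ κ ⌋)

  sdeg : ∀ {k} → EdgeColoring G k → EdgeSet n → Fin n → Fin k → ℕ
  sdeg c S v κ = sum λ w → 𝟙 (Adj G v w ∧ S v w ∧ ⌊ col c v w ≟ κ ⌋)

  degree≡deg : ∀ v → degree G v ≡ deg v
  degree≡deg v = countB≡sum (Adj G v)

  colorDegree≡cdeg : ∀ {k} (c : EdgeColoring G k) v κ → colorDegree c v κ ≡ cdeg c v κ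
  colorDegree≡cdeg c v κ = countB≡sum (λ w → Adj G v w ∧ ⌊ col c v w ≟ κ ⌋)

  deg≡∑cdeg : ∀ {k} (c : EdgeColoring G k) v → deg v ≡ sum (cdeg c v)
  deg≡∑cdeg {k} c v = trans (sum-cong-≗ split) (∑-comm (λ w κ → 𝟙 (Adj G v w ∧ ⌊ col c v w ≟ κ ⌋)))
    where
    split : ∀ w → 𝟙 (Adj G v w) ≡ sum λ κ → 𝟙 (Adj G v w ∧ ⌊ col c v w ≟ κ ⌋)
    split w with Adj G v w
    ... | false = sym (sum-zero {k} λ _ → refl)
    ... | true = sym (trans (sum-single (col c v w) λ κ κ≢ → cong 𝟙 (≟-≢ (κ≢ ∘ sym)))
                            (cong 𝟙 (≟-refl (col c v w))))

  sdeg≤cdeg : ∀ {k} (c : EdgeColoring G k) S v κ → sdeg c S v κ ≤ cdeg c v κ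
  sdeg≤cdeg c S v κ = sum-mono-≤ λ w → term (Adj G v w) (S v w) ⌊ col c v w ≟ κ ⌋
    where
    term : ∀ a s q → 𝟙 (a ∧ s ∧ q) ≤ 𝟙 (a ∧ q)
    term false _ _ = z≤n
    term true true _ = ≤-refl
    term true false _ = z≤n

  sdeg-∅ : ∀ {k} (c : EdgeColoring G k) v κ → sdeg c ∅ v κ ≡ 0
  sdeg-∅ c v κ = sum-zero λ w → cong 𝟙 (∧-zeroʳ (Adj G v w))

  sdeg-∪ : ∀ {k} (c : EdgeColoring G k) {S T} v → (∀ w → T v w ≡ true → S v w ≡ false) →
    ∀ κ → sdeg c (S ∪ T) v κ ≡ sdeg c S v κ + sdeg c T v κ
  sdeg-∪ c {S} {T} v disjoint κ =
    trans (sum-cong-≗ λ w → term (Adj G v w) (S v w) (T v w) ⌊ col c v w ≟ κ ⌋ (disjoint w))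
          (∑-distrib-+ (counted S) (counted T))
    where
    counted : EdgeSet n → Fin n → ℕ
    counted U w = 𝟙 (Adj G v w ∧ U v w ∧ ⌊ col c v w ≟ κ ⌋)
    term : ∀ a s t q → (t ≡ true → s ≡ false) → 𝟙 (a ∧ (s ∨ t) ∧ q) ≡ 𝟙 (a ∧ s ∧ q) + 𝟙 (a ∧ t ∧ q)
    term false _ _ _ _ = refl
    term true false _ _ _ = refl
    term true true false q _ = sym (+-identityʳ _)
    term true true true _ t⇒¬s with t⇒¬s refl
    ... | ()

  adjacent⇒≢ : ∀ {x w} → Adj G x w ≡ true → x ≢ w
  adjacent⇒≢ {x} xw refl = contradiction (trans (sym xw) (irrefl G x)) λ ()

  sdeg-⟪⟫ : ∀ {k} (c : EdgeColoring G k) {x w} → Adj G x w ≡ true → ∀ v κ →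
    sdeg c ⟪ x , w ⟫ v κ ≡ 𝟙 (⌊ v ≟ x ⌋ ∧ ⌊ col c x w ≟ κ ⌋) + 𝟙 (⌊ v ≟ w ⌋ ∧ ⌊ col c x w ≟ κ ⌋)
  sdeg-⟪⟫ c {x} {w} xw v κ with v ≟ x | v ≟ w
  ... | yes refl | yes refl = contradiction refl (adjacent⇒≢ xw)
  ... | yes refl | no _ = trans (sum-single w off) on
    where
    off : ∀ y → y ≢ w → 𝟙 (Adj G x y ∧ (⌊ y ≟ w ⌋ ∨ false) ∧ ⌊ col c x y ≟ κ ⌋) ≡ 0
    off y y≢w rewrite ≟-≢ y≢w = cong 𝟙 (∧-zeroʳ (Adj G x y))
    on : 𝟙 (Adj G x w ∧ (⌊ w ≟ w ⌋ ∨ false) ∧ ⌊ col c x w ≟ κ ⌋) ≡ 𝟙 ⌊ col c x w ≟ κ ⌋ + 0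
    on rewrite xw | ≟-refl w = sym (+-identityʳ _)
  ... | no _ | yes refl = trans (sum-single x off) on
    where
    off : ∀ y → y ≢ x → 𝟙 (Adj G w y ∧ ⌊ y ≟ x ⌋ ∧ ⌊ col c w y ≟ κ ⌋) ≡ 0
    off y y≢x rewrite ≟-≢ y≢x = cong 𝟙 (∧-zeroʳ (Adj G w y))
    on : 𝟙 (Adj G w x ∧ ⌊ x ≟ x ⌋ ∧ ⌊ col c w x ≟ κ ⌋) ≡ 𝟙 ⌊ col c x w ≟ κ ⌋
    on rewrite symm G w x | xw | ≟-refl x | col-sym c x w xw = refl
  ... | no _ | no _ = sum-zero λ y → cong 𝟙 (∧-zeroʳ (Adj G v y))

  sdeg-insert : ∀ {k} (c : EdgeColoring G k) {S} → Undirected S → ∀ {x w} →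
    Adj G x w ≡ true → S x w ≡ false → ∀ v κ →
    sdeg c (S ∪ ⟪ x , w ⟫) v κ ≡
      sdeg c S v κ + (𝟙 (⌊ v ≟ x ⌋ ∧ ⌊ col c x w ≟ κ ⌋) + 𝟙 (⌊ v ≟ w ⌋ ∧ ⌊ col c x w ≟ κ ⌋))
  sdeg-insert c {S} S-und {x} {w} xw xw∉S v κ =
    trans (sdeg-∪ c {S} {⟪ x , w ⟫} v disjoint κ) (cong (sdeg c S v κ +_) (sdeg-⟪⟫ c xw v κ))
    where
    disjoint : ∀ y → ⟪ x , w ⟫ v y ≡ true → S v y ≡ false
    disjoint y vy∈xw with ⟪⟫-true {x = x} {w} {v} {y} vy∈xw
    ... | inj₁ (refl , refl) = xw∉S
    ... | inj₂ (refl , refl) = trans (S-und w x) xw∉S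

  unused : EdgeSet n → ℕ
  unused S = sum λ v → sum λ w → 𝟙 (Adj G v w ∧ not (S v w))

  unused-insert : ∀ {S x w} → Adj G x w ≡ true → S x w ≡ false → unused (S ∪ ⟪ x , w ⟫) < unused S
  unused-insert {S} {x} {w} xw xw∉S =
    sum-mono-< x (λ v → sum-mono-≤ (λ y → fewer v y)) (sum-mono-< w (fewer x) at-xw)
    where
    term : ∀ a s t → 𝟙 (a ∧ not (s ∨ t)) ≤ 𝟙 (a ∧ not s)
    term false _ _ = z≤n
    term true true _ = z≤n
    term true false true = z≤n
    term true false false = ≤-refl
    fewer : ∀ v y → 𝟙 (Adj G v y ∧ not ((S ∪ ⟪ x , w ⟫) v y)) ≤ 𝟙 (Adj G v y ∧ not (S v y))
    fewer v y = term (Adj G v y) (S v y) (⟪ x , w ⟫ v y)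
    at-xw : 𝟙 (Adj G x w ∧ not ((S ∪ ⟪ x , w ⟫) x w)) < 𝟙 (Adj G x w ∧ not (S x w))
    at-xw rewrite xw | xw∉S | ≟-refl x | ≟-refl w = s≤s z≤n

  recolour : ∀ {k} → EdgeColoring G k → (S : EdgeSet n) → Undirected S → Permutation k k → EdgeColoring G k
  col (recolour c S _ π) x y = if S x y then π ⟨$⟩ʳ col c x y else col c x y
  col-sym (recolour c S S-und π) x y xy rewrite S-und x y | col-sym c x y xy = refl

  recolour-cdeg : ∀ {k} (c : EdgeColoring G k) S (S-und : Undirected S) π v κ →
    cdeg (recolour c S S-und π) v κ + sdeg c S v κ ≡ cdeg c v κ + sdeg c S v (π ⟨$⟩ˡ κ)
  recolour-cdeg c S S-und π v κ =
    trans (sym (∑-distrib-+ (λ w → 𝟙 (Adj G v w ∧ ⌊ col c′ v w ≟ κ ⌋)) _))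
          (trans (sum-cong-≗ term) (∑-distrib-+ _ (λ w → 𝟙 (Adj G v w ∧ S v w ∧ ⌊ col c v w ≟ π ⟨$⟩ˡ κ ⌋))))
    where
    c′ = recolour c S S-und π
    term : ∀ w → 𝟙 (Adj G v w ∧ ⌊ col c′ v w ≟ κ ⌋) + 𝟙 (Adj G v w ∧ S v w ∧ ⌊ col c v w ≟ κ ⌋)
               ≡ 𝟙 (Adj G v w ∧ ⌊ col c v w ≟ κ ⌋) + 𝟙 (Adj G v w ∧ S v w ∧ ⌊ col c v w ≟ π ⟨$⟩ˡ κ ⌋)
    term w with Adj G v w | S v w
    ... | false | _ = refl
    ... | true | false = refl
    ... | true | true rewrite ⟨$⟩ʳ-≟ π (col c v w) κ = +-comm (𝟙 ⌊ col c v w ≟ π ⟨$⟩ˡ κ ⌋) _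

  sdeg-saturated : ∀ {k} (c : EdgeColoring G k) S x κ →
    (∀ w → ¬ (Adj G x w ≡ true × S x w ≡ false × col c x w ≡ κ)) → sdeg c S x κ ≡ cdeg c x κ
  sdeg-saturated c S x κ none = sum-cong-≗ term
    where
    term : ∀ w → 𝟙 (Adj G x w ∧ S x w ∧ ⌊ col c x w ≟ κ ⌋) ≡ 𝟙 (Adj G x w ∧ ⌊ col c x w ≟ κ ⌋)
    term w with Adj G x w in xw | S x w in xw∈S | col c x w ≟ κ
    ... | false | _ | _ = refl
    ... | true | true | _ = refl
    ... | true | false | no _ = refl
    ... | true | false | yes xw-κ = contradiction (xw , xw∈S , xw-κ) (none w)

  swap-exchange : ∀ {k} (c : EdgeColoring G k) S (S-und : Undirected S) {α β} → α ≢ β → ∀ v →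
    Exchange (cdeg c v) (cdeg (recolour c S S-und (transpose α β)) v) (sdeg c S v) α β
  swap-exchange c S S-und {α} {β} α≢β v = record
    { at-p = swapped α (transpose-j (α≢β ∘ sym))
    ; at-q = swapped β (transpose-i β α)
    ; elsewhere = λ κ κ≢α κ≢β → +-cancelʳ-≡ (sdeg c S v κ) _ _ (swapped κ (transpose-other κ≢β κ≢α))
    }
    where
    swapped : ∀ κ {κ′} → PC.transpose β α κ ≡ κ′ →
      cdeg (recolour c S S-und (transpose α β)) v κ + sdeg c S v κ ≡ cdeg c v κ + sdeg c S v κ′
    swapped κ {κ′} eq =
      trans (recolour-cdeg c S S-und (transpose α β) v κ) (cong (λ z → cdeg c v κ + sdeg c S v z) eq)

  sdeg-pos⇒edge : ∀ {k} (c : EdgeColoring G k) S x κ → 0 < sdeg c S x κ →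
    ∃ λ w → Adj G x w ≡ true × S x w ≡ true × col c x w ≡ κ
  sdeg-pos⇒edge c S x κ 0<s
    with any? (λ w → (Adj G x w Bool.≟ true) ×-dec (S x w Bool.≟ true) ×-dec (col c x w ≟ κ))
  ... | yes edge = edge
  ... | no none = contradiction (sum-zero term) (>⇒≢ 0<s)
    where
    term : ∀ w → 𝟙 (Adj G x w ∧ S x w ∧ ⌊ col c x w ≟ κ ⌋) ≡ 0
    term w with Adj G x w in xw | S x w in xw∈S | col c x w ≟ κ
    ... | false | _ | _ = refl
    ... | true | false | _ = refl
    ... | true | true | no _ = refl
    ... | true | true | yes xw-κ = contradiction (w , xw , xw∈S , xw-κ) none

  module _ {k} (c : EdgeColoring G k) {x w} (xw : Adj G x w ≡ true) {p q} (xw-p : col c x w ≡ p) (p≢q : p ≢ q) where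

    ⟪⟫-shift : ∀ {v} → v ≡ x ⊎ v ≡ w → sdeg c ⟪ x , w ⟫ v p ≡ sdeg c ⟪ x , w ⟫ v q + 1
    ⟪⟫-shift {v} v∈xw rewrite sdeg-⟪⟫ c xw v p | sdeg-⟪⟫ c xw v q | xw-p | ≟-refl p | ≟-≢ p≢q with v∈xw
    ... | inj₁ refl rewrite ≟-refl x | ≟-≢ (adjacent⇒≢ xw) = refl
    ... | inj₂ refl rewrite ≟-refl w | ≟-≢ (adjacent⇒≢ xw ∘ sym) = refl

    ⟪⟫-elsewhere : ∀ {v} → v ≢ x → v ≢ w → sdeg c ⟪ x , w ⟫ v p ≡ sdeg c ⟪ x , w ⟫ v q
    ⟪⟫-elsewhere {v} v≢x v≢w rewrite sdeg-⟪⟫ c xw v p | sdeg-⟪⟫ c xw v q | ≟-≢ v≢x | ≟-≢ v≢w = refl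

  module _ {k : ℕ} where

    φ : EdgeColoring G k → Fin n → ℕ
    φ c v = sum (sq ∘ cdeg c v)

    Φ : EdgeColoring G k → ℕ
    Φ c = sum (φ c)

    excess : EdgeColoring G k → Fin n → ℕ
    excess c v = sum λ κ → 2 * cdeg c v κ ∸ deg v

    Excess : EdgeColoring G k → ℕ
    Excess c = sum (excess c)

    _≺_ : EdgeColoring G k → EdgeColoring G k → Set
    c′ ≺ c = ×-Lex _≡_ _<_ _<_ (Φ c′ , Excess c′) (Φ c , Excess c)

    ≺-wellFounded : WellFounded _≺_
    ≺-wellFounded = On.wellFounded (λ c → Φ c , Excess c) (×-wellFounded <-wellFounded <-wellFounded)

    excess-zero : ∀ {c v} → (∀ κ → 2 * cdeg c v κ ≤ deg v) → excess c v ≡ 0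
    excess-zero majority = sum-zero λ κ → m≤n⇒m∸n≡0 (majority κ)

    excess-pos : ∀ {c v} κ → deg v < 2 * cdeg c v κ → 0 < excess c v
    excess-pos {c} {v} κ violated = subst (_< excess c v) (sum-zero {k} λ _ → refl)
      (sum-mono-< κ (λ _ → z≤n) (m<n⇒0<n∸m violated))

    Φ-decreases : ∀ {c c′} a → (∀ v → φ c′ v ≤ φ c v) → φ c′ a < φ c a → c′ ≺ c
    Φ-decreases a φ≤ φa< = inj₁ (sum-mono-< a φ≤ φa<)

    majority-by-descent : (∀ c u κ → deg u < 2 * cdeg c u κ → ∃ λ c′ → c′ ≺ c) →
      EdgeColoring G k → Σ (EdgeColoring G k) IsMajority
    majority-by-descent improve c₀ = descend c₀ (≺-wellFounded c₀)
      where
      descend : ∀ c → Acc _≺_ c → Σ (EdgeColoring G k) IsMajority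
      descend c (acc smaller) with all? (λ u → all? (λ κ → 2 * cdeg c u κ ≤? deg u))
      ... | yes majority = c , λ u κ →
        subst₂ (λ a d → 2 * a ≤ d) (sym (colorDegree≡cdeg c u κ)) (sym (degree≡deg u)) (majority u κ)
      ... | no ¬majority with ¬∀⟶∃¬ n _ (λ u → all? (λ κ → 2 * cdeg c u κ ≤? deg u)) ¬majority
      ... | u , ¬majorityAt-u with ¬∀⟶∃¬ k _ (λ κ → 2 * cdeg c u κ ≤? deg u) ¬majorityAt-u
      ... | κ , violated with improve c u κ (≰⇒> violated)
      ... | c′ , c′≺c = descend c′ (smaller c′≺c)

  module RecolourEdge {k} (c : EdgeColoring G k) {x w} (xw : Adj G x w ≡ true) {p q}
                      (xw-p : col c x w ≡ p) (p≢q : p ≢ q) where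

    recoloured : EdgeColoring G k
    recoloured = recolour c ⟪ x , w ⟫ (⟪⟫-undirected x w) (transpose p q)

    exchange : ∀ v → Exchange (cdeg c v) (cdeg recoloured v) (sdeg c ⟪ x , w ⟫ v) p q
    exchange = swap-exchange c ⟪ x , w ⟫ (⟪⟫-undirected x w) p≢q

    moved : ∀ {v} → v ≡ x ⊎ v ≡ w → cdeg recoloured v p + 1 ≡ cdeg c v p × cdeg recoloured v q ≡ cdeg c v q + 1
    moved {v} v∈xw = exchange-shift (exchange v) (⟪⟫-shift c xw xw-p p≢q v∈xw)

    unchanged-colour : ∀ v {κ} → κ ≢ p → κ ≢ q → cdeg recoloured v κ ≡ cdeg c v κ
    unchanged-colour v = Exchange.elsewhere (exchange v) _

    unchanged : ∀ {v} → v ≢ x → v ≢ w → ∀ κ → cdeg recoloured v κ ≡ cdeg c v κ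
    unchanged {v} v≢x v≢w = exchange-balanced (exchange v) (⟪⟫-elsewhere c xw xw-p p≢q v≢x v≢w)

    φ-end-≤ : ∀ {v} → v ≡ x ⊎ v ≡ w → cdeg c v q < cdeg c v p → φ recoloured v ≤ φ c v
    φ-end-≤ {v} v∈xw q<p =
      exchange-sum-sq-≤ (exchange v) p≢q (⟪⟫-shift c xw xw-p p≢q v∈xw) (≤-from-shift 1 (proj₁ (moved v∈xw)) q<p)

    φ-end-< : ∀ {v} → v ≡ x ⊎ v ≡ w → 2 + cdeg c v q ≤ cdeg c v p → φ recoloured v < φ c v
    φ-end-< {v} v∈xw 2+q≤p =
      exchange-sum-sq-< (exchange v) p≢q (⟪⟫-shift c xw xw-p p≢q v∈xw) (<-from-shift 1 (proj₁ (moved v∈xw)) 2+q≤p)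

    φ-≤ : cdeg c x q < cdeg c x p → cdeg c w q < cdeg c w p → ∀ v → φ recoloured v ≤ φ c v
    φ-≤ at-x at-w v = by-cases (v ≟ x) (v ≟ w)
      where
      by-cases : Dec (v ≡ x) → Dec (v ≡ w) → φ recoloured v ≤ φ c v
      by-cases (yes refl) _ = φ-end-≤ (inj₁ refl) at-x
      by-cases (no _) (yes refl) = φ-end-≤ (inj₂ refl) at-w
      by-cases (no v≢x) (no v≢w) = ≤-reflexive (sum-cong-≗ (cong sq ∘ unchanged v≢x v≢w))

    improves : 2 + cdeg c x q ≤ cdeg c x p → cdeg c w q < cdeg c w p → recoloured ≺ c
    improves at-x at-w = Φ-decreases {c = c} {recoloured} x (φ-≤ (m+n≤o⇒n≤o 1 at-x) at-w) (φ-end-< (inj₁ refl) at-x)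

  module AlternatingTrail {k} (c : EdgeColoring G k) (u : Fin n) {α β : Fin k} (α≢β : α ≢ β) where

    next : Bool → Fin k
    next true = α
    next false = β

    next≟α : ∀ b → ⌊ next b ≟ α ⌋ ≡ b
    next≟α true = ≟-refl α
    next≟α false = ≟-≢ (α≢β ∘ sym)

    next≟β : ∀ b → ⌊ next b ≟ β ⌋ ≡ not b
    next≟β true = ≟-≢ α≢β
    next≟β false = ≟-refl β

    -- S is an alternating trail from u to x whose next edge must have colour next b: at every
    -- vertex its α- and β-edges pair up, except for its first edge at u and its last edge at x.
    Balanced : EdgeSet n → Fin n → Bool → Set
    Balanced S x b = ∀ v →
      sdeg c S v α + 𝟙 (⌊ v ≟ x ⌋ ∧ b) ≡ sdeg c S v β + 𝟙 ⌊ v ≟ u ⌋ + 𝟙 (⌊ v ≟ x ⌋ ∧ not b)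

    record Maximal : Set where
      constructor maximal
      field
        edges : EdgeSet n
        undirected : Undirected edges
        end : Fin n
        parity : Bool
        balanced : Balanced edges end parity
        exhausted : sdeg c edges end (next parity) ≡ cdeg c end (next parity)

    balanced-extend : ∀ {S x b w} → Undirected S → Balanced S x b →
      Adj G x w ≡ true → S x w ≡ false → col c x w ≡ next b → Balanced (S ∪ ⟪ x , w ⟫) w (not b)
    balanced-extend {S} {x} {b} {w} S-und bal xw xw∉S xw-next v = begin
      sdeg c S′ v α + 𝟙 (W ∧ not b)
        ≡⟨ cong (_+ 𝟙 (W ∧ not b)) (inserted α b (next≟α b)) ⟩
      sdeg c S v α + (𝟙 (X ∧ b) + 𝟙 (W ∧ b)) + 𝟙 (W ∧ not b)
        ≡⟨ regroup (sdeg c S v α) _ _ _ ⟩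
      sdeg c S v α + 𝟙 (X ∧ b) + (𝟙 (W ∧ b) + 𝟙 (W ∧ not b))
        ≡⟨ cong (_+ (𝟙 (W ∧ b) + 𝟙 (W ∧ not b))) (bal v) ⟩
      sdeg c S v β + U + 𝟙 (X ∧ not b) + (𝟙 (W ∧ b) + 𝟙 (W ∧ not b))
        ≡⟨ regroup′ (sdeg c S v β) U _ _ _ ⟩
      sdeg c S v β + (𝟙 (X ∧ not b) + 𝟙 (W ∧ not b)) + U + 𝟙 (W ∧ b)
        ≡⟨ cong (λ z → z + U + 𝟙 (W ∧ b)) (inserted β (not b) (next≟β b)) ⟨
      sdeg c S′ v β + U + 𝟙 (W ∧ b)
        ≡⟨ cong (λ z → sdeg c S′ v β + U + 𝟙 (W ∧ z)) (not-involutive b) ⟨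
      sdeg c S′ v β + U + 𝟙 (W ∧ not (not b))
        ∎
      where
      open ≡-Reasoning
      S′ = S ∪ ⟪ x , w ⟫
      X = ⌊ v ≟ x ⌋
      W = ⌊ v ≟ w ⌋
      U = 𝟙 ⌊ v ≟ u ⌋
      inserted : ∀ κ z → ⌊ next b ≟ κ ⌋ ≡ z → sdeg c S′ v κ ≡ sdeg c S v κ + (𝟙 (X ∧ z) + 𝟙 (W ∧ z))
      inserted κ z next≟κ rewrite sdeg-insert c S-und xw xw∉S v κ | xw-next | next≟κ = refl
      regroup : ∀ a x y z → a + (x + y) + z ≡ a + x + (y + z)
      regroup = solve-∀
      regroup′ : ∀ a u x y z → a + u + x + (y + z) ≡ a + (x + z) + u + y
      regroup′ = solve-∀

    grow : ∀ S → Undirected S → ∀ x b → Balanced S x b → Acc _<_ (unused S) → Maximal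
    grow S S-und x b bal (acc smaller)
      with any? (λ w → (Adj G x w Bool.≟ true) ×-dec (S x w Bool.≟ false) ×-dec (col c x w ≟ next b))
    ... | yes (w , xw , xw∉S , xw-next) =
      grow (S ∪ ⟪ x , w ⟫) (∪-undirected S-und (⟪⟫-undirected x w)) w (not b)
           (balanced-extend S-und bal xw xw∉S xw-next) (smaller (unused-insert xw xw∉S))
    ... | no none = maximal S S-und x b bal (sdeg-saturated c S x (next b) λ w p → none (w , p))

    balanced-∅ : Balanced ∅ u true
    balanced-∅ v rewrite sdeg-∅ c v α | ∧-identityʳ ⌊ v ≟ u ⌋ | ∧-zeroʳ ⌊ v ≟ u ⌋ =
      sym (+-identityʳ _)

    maximalTrail : Maximal
    maximalTrail = grow ∅ ∅-undirected u true balanced-∅ (<-wellFounded _)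

    module _ {S : EdgeSet n} {x : Fin n} {b : Bool} (bal : Balanced S x b) where

      balanced-elsewhere : ∀ {v} → v ≢ u → v ≢ x → sdeg c S v α ≡ sdeg c S v β
      balanced-elsewhere {v} v≢u v≢x with bal v
      ... | eq rewrite ≟-≢ v≢u | ≟-≢ v≢x = trans (sym (+-identityʳ _)) (trans eq (trans (+-identityʳ _) (+-identityʳ _)))

      balanced-start : x ≢ u → sdeg c S u α ≡ sdeg c S u β + 1
      balanced-start x≢u with bal u
      ... | eq rewrite ≟-≢ (x≢u ∘ sym) | ≟-refl u = trans (sym (+-identityʳ _)) (trans eq (+-identityʳ _))

    module _ {S : EdgeSet n} {x : Fin n} where

      balanced-endα : Balanced S x false → x ≢ u → sdeg c S x α ≡ sdeg c S x β + 1
      balanced-endα bal x≢u with bal x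
      ... | eq rewrite ≟-≢ x≢u | ≟-refl x = trans (sym (+-identityʳ _)) (trans eq (cong (_+ 1) (+-identityʳ _)))

      balanced-endβ : Balanced S x true → x ≢ u → sdeg c S x β ≡ sdeg c S x α + 1
      balanced-endβ bal x≢u with bal x
      ... | eq rewrite ≟-≢ x≢u | ≟-refl x = sym (trans eq (trans (+-identityʳ _) (+-identityʳ _)))

    balanced-closedα : ∀ {S} → Balanced S u true → sdeg c S u α ≡ sdeg c S u β
    balanced-closedα {S} bal with bal u
    ... | eq rewrite ≟-refl u = +-cancelʳ-≡ 1 _ _ (trans eq (+-identityʳ _))

    balanced-closedβ : ∀ {S} → Balanced S u false → sdeg c S u α ≡ sdeg c S u β + 2
    balanced-closedβ {S} bal with bal u
    ... | eq rewrite ≟-refl u = trans (sym (+-identityʳ _)) (trans eq (+-assoc (sdeg c S u β) 1 1))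

    closed-α-bound : ∀ {S} → Balanced S u true → sdeg c S u α ≡ cdeg c u α → cdeg c u α ≤ cdeg c u β
    closed-α-bound {S} bal exh = begin
      cdeg c u α    ≡⟨ exh ⟨
      sdeg c S u α  ≡⟨ balanced-closedα bal ⟩
      sdeg c S u β  ≤⟨ sdeg≤cdeg c S u β ⟩
      cdeg c u β    ∎
      where open ≤-Reasoning

    module Flip {S : EdgeSet n} (S-und : Undirected S) where

      flipped : EdgeColoring G k
      flipped = recolour c S S-und (transpose α β)

      exchange : ∀ v → Exchange (cdeg c v) (cdeg flipped v) (sdeg c S v) α β
      exchange = swap-exchange c S S-und α≢β

      flip-unchanged : ∀ {v} → sdeg c S v α ≡ sdeg c S v β → ∀ κ → cdeg flipped v κ ≡ cdeg c v κ
      flip-unchanged {v} = exchange-balanced (exchange v)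

      φ-flip-unchanged : ∀ {v} → sdeg c S v α ≡ sdeg c S v β → φ flipped v ≡ φ c v
      φ-flip-unchanged sα≡sβ = sum-cong-≗ (cong sq ∘ flip-unchanged sα≡sβ)

      φ-flip-end : ∀ {x b} → Balanced S x b → sdeg c S x (next b) ≡ cdeg c x (next b) → x ≢ u →
        φ flipped x ≤ φ c x
      φ-flip-end {x} {true} bal exh x≢u = exchange-sum-sq-≤-saturated (exchange-flip (exchange x)) (α≢β ∘ sym)
        (balanced-endβ bal x≢u) exh (sdeg≤cdeg c S x β)
      φ-flip-end {x} {false} bal exh x≢u = exchange-sum-sq-≤-saturated (exchange x) α≢β
        (balanced-endα bal x≢u) exh (sdeg≤cdeg c S x α)

      open-flip-improves : ∀ {x b} → Balanced S x b → sdeg c S x (next b) ≡ cdeg c x (next b) → x ≢ u →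
        2 + cdeg c u β ≤ cdeg c u α → flipped ≺ c
      open-flip-improves {x} bal exh x≢u 2+β≤α = Φ-decreases {c = c} {flipped} u φ≤ at-u
        where
        surplus = balanced-start bal x≢u
        at-u : φ flipped u < φ c u
        at-u = exchange-sum-sq-< (exchange u) α≢β surplus
          (<-from-shift 1 (proj₁ (exchange-shift (exchange u) surplus)) 2+β≤α)
        φ≤ : ∀ v → φ flipped v ≤ φ c v
        φ≤ v with v ≟ u | v ≟ x
        ... | yes refl | _ = <⇒≤ at-u
        ... | no _ | yes refl = φ-flip-end bal exh x≢u
        ... | no v≢u | no v≢x = ≤-reflexive (φ-flip-unchanged {v} (balanced-elsewhere bal v≢u v≢x))

      φ-flip-closed-≤ : Balanced S u false → 2 + cdeg c u β ≤ cdeg c u α → φ flipped u ≤ φ c u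
      φ-flip-closed-≤ bal 2+β≤α = exchange-sum-sq-≤ (exchange u) α≢β surplus
        (≤-from-shift 2 (proj₁ (exchange-shift (exchange u) surplus)) 2+β≤α)
        where surplus = balanced-closedβ bal

      closed-flip-improves : Balanced S u false → sdeg c S u β ≡ cdeg c u β →
        3 + cdeg c u β ≤ cdeg c u α → flipped ≺ c
      closed-flip-improves bal exh 3+β≤α = Φ-decreases {c = c} {flipped} u φ≤ at-u
        where
        surplus = balanced-closedβ bal
        at-u : φ flipped u < φ c u
        at-u = exchange-sum-sq-< (exchange u) α≢β surplus
          (<-from-shift 2 (proj₁ (exchange-shift (exchange u) surplus)) 3+β≤α)
        φ≤ : ∀ v → φ flipped v ≤ φ c v
        φ≤ v with v ≟ u
        ... | yes refl = <⇒≤ at-u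
        ... | no v≢u = ≤-reflexive (φ-flip-unchanged {v} (balanced-elsewhere bal v≢u v≢u))

  module Improvement (δ : ∀ v → 4 ≤ deg v) (c : EdgeColoring G 3) (u : Fin n) (ρ : Permutation 3 3)
                     (violated : deg u < 2 * cdeg c u (ρ ⟨$⟩ʳ 0F))
                     (B≤Γ : cdeg c u (ρ ⟨$⟩ʳ 1F) ≤ cdeg c u (ρ ⟨$⟩ʳ 2F)) where

    α β γ : Fin 3
    α = ρ ⟨$⟩ʳ 0F
    β = ρ ⟨$⟩ʳ 1F
    γ = ρ ⟨$⟩ʳ 2F

    ρ-≢ : ∀ {i j} → i ≢ j → ρ ⟨$⟩ʳ i ≢ ρ ⟨$⟩ʳ j
    ρ-≢ i≢j ρi≡ρj = i≢j (trans (sym (inverseˡ ρ)) (trans (cong (ρ ⟨$⟩ˡ_) ρi≡ρj) (inverseˡ ρ)))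

    α≢β : α ≢ β
    α≢β = ρ-≢ λ ()

    α≢γ : α ≢ γ
    α≢γ = ρ-≢ λ ()

    γ≢α : γ ≢ α
    γ≢α = ρ-≢ λ ()

    γ≢β : γ ≢ β
    γ≢β = ρ-≢ λ ()

    colour-cases : ∀ κ → κ ≡ α ⊎ κ ≡ β ⊎ κ ≡ γ
    colour-cases κ with ρ ⟨$⟩ˡ κ in ρ⁻¹κ
    ... | 0F = inj₁ (trans (sym (inverseʳ ρ)) (cong (ρ ⟨$⟩ʳ_) ρ⁻¹κ))
    ... | 1F = inj₂ (inj₁ (trans (sym (inverseʳ ρ)) (cong (ρ ⟨$⟩ʳ_) ρ⁻¹κ)))
    ... | 2F = inj₂ (inj₂ (trans (sym (inverseʳ ρ)) (cong (ρ ⟨$⟩ʳ_) ρ⁻¹κ)))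

    deg≡αβγ : ∀ (c′ : EdgeColoring G 3) v → deg v ≡ cdeg c′ v α + (cdeg c′ v β + cdeg c′ v γ)
    deg≡αβγ c′ v = trans (deg≡∑cdeg c′ v) (trans (sum-permute (cdeg c′ v) ρ)
      (cong (λ z → cdeg c′ v α + (cdeg c′ v β + z)) (+-identityʳ _)))

    A B Γ : ℕ
    A = cdeg c u α
    B = cdeg c u β
    Γ = cdeg c u γ

    open AlternatingTrail c u α≢β

    B+Γ<A : B + Γ < A
    B+Γ<A = +-cancelˡ-< A (B + Γ) A (begin-strict
      A + (B + Γ)  ≡⟨ deg≡αβγ c u ⟨
      deg u        <⟨ violated ⟩
      2 * A        ≡⟨ cong (A +_) (+-identityʳ A) ⟩
      A + A        ∎)
      where open ≤-Reasoning

    cases : 3 + B ≤ A ⊎ (A ≡ 3 × B ≡ 1 × Γ ≡ 1)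
    cases = violation-cases A B Γ (subst (4 ≤_) (deg≡αβγ c u) (δ u)) B+Γ<A B≤Γ

    2+B≤A : 2 + B ≤ A
    2+B≤A = violation-margin cases

    module Special (A≡3 : A ≡ 3) (B≡1 : B ≡ 1) (Γ≡1 : Γ ≡ 1)
                   {S : EdgeSet n} (S-und : Undirected S) (bal : Balanced S u false)
                   {v : Fin n} (uv : Adj G u v ≡ true) (uv∈S : S u v ≡ true) (uv-α : col c u v ≡ α) where

      v≢u : v ≢ u
      v≢u = adjacent⇒≢ uv ∘ sym

      2+Γ≤A : 2 + Γ ≤ A
      2+Γ≤A = subst₂ (λ g a → 2 + g ≤ a) (sym Γ≡1) (sym A≡3) ≤-refl

      module Toβ = RecolourEdge c uv uv-α α≢β
      module Toγ = RecolourEdge c uv uv-α α≢γ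

      recolour-β : cdeg c v β < cdeg c v α → ∃ λ c′ → c′ ≺ c
      recolour-β β<α = Toβ.recoloured , Toβ.improves 2+B≤A β<α

      recolour-γ : cdeg c v γ < cdeg c v α → ∃ λ c′ → c′ ≺ c
      recolour-γ γ<α = Toγ.recoloured , Toγ.improves 2+Γ≤A γ<α

      module F = Flip S-und
      flipped-uv : col F.flipped u v ≡ β
      flipped-uv rewrite uv∈S | uv-α = transpose-i α β

      module R = RecolourEdge F.flipped uv flipped-uv (α≢β ∘ sym)

      flip-and-restore : cdeg c v α < cdeg c v β → ∃ λ c′ → c′ ≺ c
      flip-and-restore α<β = R.recoloured , Φ-decreases {c = c} {R.recoloured} u φ≤ at-u
        where
        shifted = exchange-shift (F.exchange u) (balanced-closedβ bal)
        flipped-α : cdeg F.flipped u α ≡ 1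
        flipped-α = +-cancelʳ-≡ 2 _ 1 (trans (proj₁ shifted) A≡3)
        flipped-β : cdeg F.flipped u β ≡ 3
        flipped-β = trans (proj₂ shifted) (cong (_+ 2) B≡1)
        unchanged-v : ∀ κ → cdeg F.flipped v κ ≡ cdeg c v κ
        unchanged-v = F.flip-unchanged (balanced-elsewhere bal v≢u v≢u)
        at-u : φ R.recoloured u < φ c u
        at-u = <-≤-trans (R.φ-end-< (inj₁ refl) (subst₂ (λ a b → 2 + a ≤ b) (sym flipped-α) (sym flipped-β) ≤-refl))
                         (F.φ-flip-closed-≤ bal 2+B≤A)
        φ≤ : ∀ x → φ R.recoloured x ≤ φ c x
        φ≤ x = ≤-trans
          (R.φ-≤ (subst₂ _<_ (sym flipped-α) (sym flipped-β) (s≤s (s≤s z≤n)))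
                 (subst₂ _<_ (sym (unchanged-v α)) (sym (unchanged-v β)) α<β) x)
          (flip-≤ x)
          where
          flip-≤ : ∀ x → φ F.flipped x ≤ φ c x
          flip-≤ x with x ≟ u
          ... | yes refl = F.φ-flip-closed-≤ bal 2+B≤A
          ... | no x≢u = ≤-reflexive (F.φ-flip-unchanged {x} (balanced-elsewhere bal x≢u x≢u))

      tie : cdeg c v α ≡ cdeg c v β → cdeg c v α ≤ cdeg c v γ → ∃ λ c′ → c′ ≺ c
      tie α≡β α≤γ = c′ , inj₂ (Φ-same , sum-mono-< u excess-≤ excess-u)
        where
        c′ = Toβ.recoloured
        at-u = Toβ.moved (inj₁ refl)
        at-v = Toβ.moved (inj₂ refl)

        recoloured-u-α : cdeg c′ u α ≡ 2
        recoloured-u-α = +-cancelʳ-≡ 1 _ 2 (trans (proj₁ at-u) A≡3)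

        recoloured-v-α : cdeg c′ v α + 1 ≡ cdeg c v β
        recoloured-v-α = trans (proj₁ at-v) α≡β

        recoloured-v-α-≤ : cdeg c′ v α ≤ cdeg c v β + 1
        recoloured-v-α-≤ = ≤-trans (m≤m+n _ 1) (≤-trans (≤-reflexive recoloured-v-α) (m≤m+n _ 1))

        rebalance : ∀ X Y X′ Y′ m → X + 2 * 1 * 2 ≡ Y + 2 * 1 * 1 → X′ + 2 * 1 * m ≡ Y′ + 2 * 1 * (m + 1) →
          X + X′ ≡ Y + Y′
        rebalance X Y X′ Y′ m eu ev = +-cancelʳ-≡ (2 * m + 4) _ _ (begin
          X + X′ + (2 * m + 4)                         ≡⟨ split X X′ m ⟩
          (X + 2 * 1 * 2) + (X′ + 2 * 1 * m)           ≡⟨ cong₂ _+_ eu ev ⟩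
          (Y + 2 * 1 * 1) + (Y′ + 2 * 1 * (m + 1))     ≡⟨ merge Y Y′ m ⟩
          Y + Y′ + (2 * m + 4)                         ∎)
          where
          open ≡-Reasoning
          split : ∀ X X′ m → X + X′ + (2 * m + 4) ≡ (X + 2 * 1 * 2) + (X′ + 2 * 1 * m)
          split = solve-∀
          merge : ∀ Y Y′ m → (Y + 2 * 1 * 1) + (Y′ + 2 * 1 * (m + 1)) ≡ Y + Y′ + (2 * m + 4)
          merge = solve-∀

        φ-local : φ c′ u + φ c′ v ≡ φ c u + φ c v
        φ-local = rebalance (φ c′ u) (φ c u) (φ c′ v) (φ c v) (cdeg c′ v α)
          (subst₂ (λ a b → φ c′ u + 2 * 1 * a ≡ φ c u + 2 * 1 * b) recoloured-u-α B≡1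
            (exchange-sum-sq (Toβ.exchange u) α≢β (⟪⟫-shift c uv uv-α α≢β (inj₁ refl))))
          (subst (λ b → φ c′ v + 2 * 1 * cdeg c′ v α ≡ φ c v + 2 * 1 * b) (sym recoloured-v-α)
            (exchange-sum-sq (Toβ.exchange v) α≢β (⟪⟫-shift c uv uv-α α≢β (inj₂ refl))))

        Φ-same : Φ c′ ≡ Φ c
        Φ-same = +-cancelʳ-≡ (φ c u + φ c v) _ _ (trans
          (sum-update₂ (v≢u ∘ sym) λ x x≢u x≢v → sum-cong-≗ (cong sq ∘ Toβ.unchanged x≢u x≢v))
          (cong (Φ c +_) φ-local))

        deg-u : deg u ≡ 5
        deg-u = trans (deg≡αβγ c u) (cong₂ _+_ A≡3 (cong₂ _+_ B≡1 Γ≡1))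

        majority-u : ∀ κ → 2 * cdeg c′ u κ ≤ deg u
        majority-u κ = ≤-trans (*-monoʳ-≤ 2 (at-most-2 (colour-cases κ))) (subst (4 ≤_) (sym deg-u) (n≤1+n 4))
          where
          at-most-2 : κ ≡ α ⊎ κ ≡ β ⊎ κ ≡ γ → cdeg c′ u κ ≤ 2
          at-most-2 (inj₁ refl) = ≤-reflexive recoloured-u-α
          at-most-2 (inj₂ (inj₁ refl)) = ≤-reflexive (trans (proj₂ at-u) (cong (_+ 1) B≡1))
          at-most-2 (inj₂ (inj₂ refl)) =
            ≤-trans (≤-reflexive (trans (Toβ.unchanged-colour u γ≢α γ≢β) Γ≡1)) (n≤1+n 1)

        excess-u : excess c′ u < excess c u
        excess-u = subst (_< excess c u) (sym (excess-zero {c = c′} {u} majority-u)) (excess-pos {c = c} {u} α violated)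

        room : 2 * (cdeg c v β + 1) ≤ deg v
        room = subst₂ (λ b d → 2 * (b + 1) ≤ d) α≡β (sym deg-v)
          (room-for-one-more α≤γ (subst (4 ≤_) deg-v (δ v)))
          where
          deg-v : deg v ≡ cdeg c v α + (cdeg c v α + cdeg c v γ)
          deg-v = trans (deg≡αβγ c v) (cong (λ b → cdeg c v α + (b + cdeg c v γ)) (sym α≡β))

        excess-v : excess c′ v ≤ excess c v
        excess-v = sum-mono-≤ λ κ → by-colour κ (colour-cases κ)
          where
          no-excess : ∀ κ → 2 * cdeg c′ v κ ≤ deg v → 2 * cdeg c′ v κ ∸ deg v ≤ 2 * cdeg c v κ ∸ deg v
          no-excess κ bounded = subst (_≤ 2 * cdeg c v κ ∸ deg v) (sym (m≤n⇒m∸n≡0 bounded)) z≤n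
          by-colour : ∀ κ → κ ≡ α ⊎ κ ≡ β ⊎ κ ≡ γ → 2 * cdeg c′ v κ ∸ deg v ≤ 2 * cdeg c v κ ∸ deg v
          by-colour κ (inj₁ refl) = no-excess κ (≤-trans (*-monoʳ-≤ 2 recoloured-v-α-≤) room)
          by-colour κ (inj₂ (inj₁ refl)) = no-excess κ (subst (λ b → 2 * b ≤ deg v) (sym (proj₂ at-v)) room)
          by-colour κ (inj₂ (inj₂ refl)) =
            ≤-reflexive (cong (λ z → 2 * z ∸ deg v) (Toβ.unchanged-colour v γ≢α γ≢β))

        excess-≤ : ∀ x → excess c′ x ≤ excess c x
        excess-≤ x = by-cases (x ≟ u) (x ≟ v)
          where
          by-cases : Dec (x ≡ u) → Dec (x ≡ v) → excess c′ x ≤ excess c x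
          by-cases (yes refl) _ = <⇒≤ excess-u
          by-cases (no _) (yes refl) = excess-v
          by-cases (no x≢u) (no x≢v) =
            ≤-reflexive (sum-cong-≗ λ κ → cong (λ z → 2 * z ∸ deg x) (Toβ.unchanged x≢u x≢v κ))

      better : ∃ λ c′ → c′ ≺ c
      better with <-cmp (cdeg c v α) (cdeg c v β)
      ... | tri< α<β _ _ = flip-and-restore α<β
      ... | tri> _ _ β<α = recolour-β β<α
      ... | tri≈ _ α≡β _ with <-cmp (cdeg c v γ) (cdeg c v α)
      ...   | tri< γ<α _ _ = recolour-γ γ<α
      ...   | tri≈ _ γ≡α _ = tie α≡β (≤-reflexive (sym γ≡α))
      ...   | tri> _ _ α<γ = tie α≡β (<⇒≤ α<γ)

    from-trail : ∀ {S : EdgeSet n} → Undirected S → ∀ {x} → Dec (x ≡ u) → ∀ b →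
      Balanced S x b → sdeg c S x (next b) ≡ cdeg c x (next b) → ∃ λ c′ → c′ ≺ c
    from-trail S-und (no x≢u) b bal exh = Flip.flipped S-und , Flip.open-flip-improves S-und bal exh x≢u 2+B≤A
    from-trail S-und (yes refl) true bal exh = contradiction (closed-α-bound bal exh) (<⇒≱ (m+n≤o⇒n≤o 1 2+B≤A))
    from-trail {S} S-und (yes refl) false bal exh = closed cases
      where
      closed : 3 + B ≤ A ⊎ (A ≡ 3 × B ≡ 1 × Γ ≡ 1) → ∃ λ c′ → c′ ≺ c
      closed (inj₁ 3+B≤A) = Flip.flipped S-und , Flip.closed-flip-improves S-und bal exh 3+B≤A
      closed (inj₂ (A≡3 , B≡1 , Γ≡1)) with sdeg-pos⇒edge c S u α α-edges
        where
        α-edges : 0 < sdeg c S u α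
        α-edges = subst (0 <_) (sym (trans (balanced-closedβ bal) (+-comm (sdeg c S u β) 2))) (s≤s z≤n)
      ... | v , uv , uv∈S , uv-α = Special.better A≡3 B≡1 Γ≡1 S-und bal uv uv∈S uv-α

    better : ∃ λ c′ → c′ ≺ c
    better = from-trail undirected (end ≟ u) parity balanced exhausted
      where open Maximal maximalTrail

  -- Both permutations send 0 to κ; they differ by swapping the images of 1 and 2, so that β is the rarer colour.
  improve : (∀ v → 4 ≤ deg v) → ∀ (c : EdgeColoring G 3) u κ → deg u < 2 * cdeg c u κ → ∃ λ c′ → c′ ≺ c
  improve δ c u κ violated with cdeg c u (PC.transpose 0F κ 1F) ≤? cdeg c u (PC.transpose 0F κ 2F)
  ... | yes ≤ = Improvement.better δ c u (transpose 0F κ) violated ≤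
  ... | no ≰ = Improvement.better δ c u (transpose 1F 2F ∘ₚ transpose 0F κ) violated (<⇒≤ (≰⇒> ≰))

monochromatic : ∀ {n} (G : SimpleGraph n) → EdgeColoring G 3
monochromatic G = record { col = λ _ _ → 0F ; col-sym = λ _ _ _ → refl }

theorem3 : (n : ℕ) (G : SimpleGraph n) → MinDegreeAtLeast G 4 →
    Σ (EdgeColoring G 3) (λ c → IsMajority c)
theorem3 n G δ = majority-by-descent G (improve G (λ v → subst (4 ≤_) (degree≡deg G v) (δ v))) (monochromatic G)
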